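{- Let $R$ and $S$ be TRSs over disjoint ranked alphabets $\Sigma$ and $\Delta$, respectively, such that no left-hand side of a rule of $R\oplus S$ is a variable. If $R\oplus S$ is an EPRF-TRS, then $R$ and $S$ are also EPRF-TRSs.
   Context: A ranked alphabet is a finite set of symbols with ranks; $X$ a countable set of variables, $T_\Sigma(X)$ the terms, $T_\Sigma$ the ground terms. A TRS over $\Sigma$ is a finite set of rules $l\to r$, $l,r\in T_\Sigma(X)$, with every variable of $r$ occurring in $l$; $sign(R)$ is the set of symbols in its rules. For TRSs $R$, $S$ over disjoint alphabets $\Sigma$, $\Delta$, $R\oplus S$ is the TRS $R\cup S$ over $\Sigma\cup\Delta$. $R^*_\Gamma(L)=\{p\mid q\Rightarrow^*_R p,\ q\in L\}$. A bottom-up tree automaton (bta) over $\Gamma$ is a finite automaton with states (treated as constants), final states, rules $\delta(a_1,\dots,a_n)\to a$ and $a\to a'$, recognizing the ground terms rewriting to a final state. $R$ is an EPRF-TRS if for any given ranked alphabet $\Gamma\supseteq sign(R)$ and finite $L\subseteq T_\Gamma$ one can effectively construct a bta $\mathcal{C}$ over $\Gamma$ with $L(\mathcal{C})=R^*_\Gamma(L)$. -}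

module Defs where

open import Data.Nat using (ℕ)
open import Data.Fin using (Fin)
open import Data.Bool using (Bool; true)
open import Data.Empty using (⊥)
open import Data.Product using (Σ; ∃; _×_; _,_)
open import Data.List using (List; _++_)
open import Data.List.Membership.Propositional using (_∈_)
open import Data.List.Relation.Unary.All using (All)
open import Data.Vec using (Vec; lookup; _[_]≔_; map)
import Data.Vec as Vec
import Data.Vec.Relation.Unary.All as VAll
import Data.Vec.Relation.Unary.Any as VAny
open import Relation.Nullary using (¬_)
open import Relation.Binary.PropositionalEquality using (_≡_)
open import Relation.Binary.Construct.Closure.ReflexiveTransitive using (Star)
open import Function.Bundles using (_⇔_)

record Sym : Set where
  constructor mkSym
  field
    name : ℕ
    ar   : ℕ
open Sym public

RankedAlphabet : Set
RankedAlphabet = List Sym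

-- Terms with variables from X = ℕ and constants from a set Q
-- (Q = ⊥ for ordinary terms; Q = states of an automaton for the
-- configurations of a bottom-up tree automaton, states being constants).

data Tm (Q : Set) : Set where
  var  : ℕ → Tm Q
  st   : Q → Tm Q
  node : (f : Sym) → Vec (Tm Q) (ar f) → Tm Q

Term : Set
Term = Tm ⊥

data Over (Γ : RankedAlphabet) : Term → Set where
  var  : ∀ x → Over Γ (var x)
  node : ∀ {f ts} → f ∈ Γ → VAll.All (Over Γ) ts → Over Γ (node f ts)

data Ground (Γ : RankedAlphabet) : Term → Set where
  node : ∀ {f ts} → f ∈ Γ → VAll.All (Ground Γ) ts → Ground Γ (node f ts)

data Occurs (x : ℕ) : Term → Set where
  here : Occurs x (var x)
  arg  : ∀ {f ts} → VAny.Any (Occurs x) ts → Occurs x (node f ts)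

data SymOcc (f : Sym) : Term → Set where
  here : ∀ {ts} → SymOcc f (node f ts)
  arg  : ∀ {g ts} → VAny.Any (SymOcc f) ts → SymOcc f (node g ts)

mutual
  subst : (ℕ → Term) → Term → Term
  subst σ (var x)     = σ x
  subst σ (st ())
  subst σ (node f ts) = node f (substs σ ts)

  substs : ∀ {n} → (ℕ → Term) → Vec Term n → Vec Term n
  substs σ Vec.[]       = Vec.[]
  substs σ (t Vec.∷ ts) = subst σ t Vec.∷ substs σ ts

Rule : Set
Rule = Term × Term

TRS : Set
TRS = List Rule

IsTRSOver : RankedAlphabet → TRS → Set
IsTRSOver Σ R = ∀ {l r} → (l , r) ∈ R →
  Over Σ l × Over Σ r × (∀ x → Occurs x r → Occurs x l)

SignSubset : TRS → RankedAlphabet → Set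
SignSubset R Γ = ∀ {l r} → (l , r) ∈ R → ∀ f →
  (SymOcc f l → f ∈ Γ) × (SymOcc f r → f ∈ Γ)

Disjoint : RankedAlphabet → RankedAlphabet → Set
Disjoint Σ Δ = ∀ f → f ∈ Σ → ¬ (f ∈ Δ)

-- R ⊕ S (as a rule set; its alphabet is Σ ∪ Δ)
_⊕_ : TRS → TRS → TRS
R ⊕ S = R ++ S

IsVar : Term → Set
IsVar t = ∃ λ x → t ≡ var x

NoVariableLhs : TRS → Set
NoVariableLhs R = ∀ {l r} → (l , r) ∈ R → ¬ IsVar l

data Step (R : TRS) : Term → Term → Set where
  root : ∀ {l r} (σ : ℕ → Term) → (l , r) ∈ R → Step R (subst σ l) (subst σ r)
  arg  : ∀ {f ts u} (i : Fin (ar f)) → Step R (lookup ts i) u →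
         Step R (node f ts) (node f (ts [ i ]≔ u))

_⇒*[_]_ : Term → TRS → Term → Set
s ⇒*[ R ] t = Star (Step R) s t

Desc : TRS → RankedAlphabet → List Term → Term → Set
Desc R Γ L p = Ground Γ p × ∃ λ q → q ∈ L × (q ⇒*[ R ] p)

record BRule (Γ : RankedAlphabet) (n : ℕ) : Set where
  constructor brule
  field
    sym   : Sym
    sym∈  : sym ∈ Γ
    args  : Vec (Fin n) (ar sym)
    target : Fin n

record BTA (Γ : RankedAlphabet) : Set where
  field
    nStates  : ℕ
    final    : Fin nStates → Bool
    rules    : List (BRule Γ nStates)
    epsRules : List (Fin nStates × Fin nStates)

-- one move of the automaton, viewed as a rewrite system on terms over Γ ∪ Q
data BStep {Γ} (C : BTA Γ) : Tm (Fin (BTA.nStates C)) → Tm (Fin (BTA.nStates C)) → Set where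
  rule : ∀ {f f∈ as a} → brule f f∈ as a ∈ BTA.rules C →
         BStep C (node f (map st as)) (st a)
  eps  : ∀ {a a'} → (a , a') ∈ BTA.epsRules C → BStep C (st a) (st a')
  arg  : ∀ {f ts u} (i : Fin (ar f)) → BStep C (lookup ts i) u →
         BStep C (node f ts) (node f (ts [ i ]≔ u))

mutual
  embed : ∀ {Q} → Term → Tm Q
  embed (var x)     = var x
  embed (st ())
  embed (node f ts) = node f (embeds ts)

  embeds : ∀ {Q n} → Vec Term n → Vec (Tm Q) n
  embeds Vec.[]       = Vec.[]
  embeds (t Vec.∷ ts) = embed t Vec.∷ embeds ts

Lang : ∀ {Γ} → BTA Γ → Term → Set
Lang {Γ} C t = Ground Γ t ×
  ∃ λ q → BTA.final C q ≡ true × Star (BStep C) (embed t) (st q)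

-- EPRF-TRS: for every ranked alphabet Γ ⊇ sign(R) and finite L ⊆ T_Γ
-- one can effectively (constructively) build a bta C over Γ with
-- L(C) = R*_Γ(L).

EPRF : TRS → Set
EPRF R = (Γ : RankedAlphabet) → SignSubset R Γ →
  (L : List Term) → All (Ground Γ) L →
  Σ (BTA Γ) λ C → ∀ t → Lang C t ⇔ Desc R Γ L t

module Submission where

-- Let A ⊆ T ⊆ A ∪ B, where A is a TRS over Σ, B a TRS over Δ with no
-- variable left-hand side, and Σ, Δ disjoint.  If T is EPRF then so is A
-- (lemma eprf-component); Theorem 19 is two instances of this, with
-- (A , B) = (R , S) and (A , B) = (S , R).
--
-- Given Γ ⊇ sign(A) and a finite L ⊆ T_Γ, the symbols of Γ ∩ Δ may carry
-- B-redexes that A cannot rewrite, so we first rename them apart: a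
-- renaming φ that fixes Σ, is invertible on Γ and sends Γ outside Δ
-- (Separation).  On φ-images of ground Γ-terms every T-redex is an
-- A-redex, so T-derivations from φ(L) are exactly the φ-images of
-- A-derivations from L (reach-forward, reach-backward).  The automaton
-- that T being EPRF yields for Γ' = φ(Γ) ∪ Δ and φ(L) is finally pulled
-- back along φ to an automaton over Γ (Pullback).

open import Defs
open import Data.Bool using (true)
open import Data.Empty using (⊥; ⊥-elim)
open import Data.Fin using (Fin; zero; suc)
open import Data.List using (List; []; _∷_; _++_; concat)
import Data.List as List
open import Data.List.Extrema.Nat using (max; xs≤max)
open import Data.List.Membership.Propositional using (_∈_; _∉_)
open import Data.List.Membership.Propositional.Properties
  using (∈-++⁺ˡ; ∈-++⁺ʳ; ∈-++⁻; ∈-map⁺; ∈-map⁻; ∈-concat⁺′; ∈-concat⁻′)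
open import Data.List.Relation.Binary.Subset.Propositional using (_⊆_)
open import Data.List.Relation.Unary.All using (All)
import Data.List.Relation.Unary.All as All
import Data.List.Relation.Unary.All.Properties as All
open import Data.List.Relation.Unary.Any using (here; there)
open import Data.Nat using (ℕ; suc; _<_; _+_; _∸_; _≤?_; s≤s)
open import Data.Nat.Properties using (_≟_; m≤m+n; m+n∸m≡n; <⇒≱)
open import Data.Product using (∃; _×_; _,_; proj₁; proj₂; map₂)
open import Data.Sum using (_⊎_; inj₁; inj₂; swap)
open import Data.Vec using (Vec; []; _∷_; lookup; _[_]≔_)
import Data.Vec as Vec
open import Data.Vec.Properties using (∷-injectiveˡ; ∷-injectiveʳ)
import Data.Vec.Relation.Unary.All as VAll
import Data.Vec.Relation.Unary.All.Properties as VAll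
import Data.Vec.Relation.Unary.Any as VAny
open import Function using (_∘_)
open import Function.Bundles using (_⇔_; mk⇔; Equivalence)
open import Relation.Binary.Construct.Closure.ReflexiveTransitive using (Star; ε; _◅_; gmap)
open import Relation.Binary.Definitions using (DecidableEquality)
open import Relation.Binary.PropositionalEquality as ≡ using (_≡_; refl; sym; trans; cong; cong₂)
open import Relation.Nullary using (yes; no)
open import Relation.Nullary.Decidable using (map′; _×-dec_)

_≟Sym_ : DecidableEquality Sym
mkSym n k ≟Sym mkSym n' k' =
  map′ (λ { (refl , refl) → refl }) (λ { refl → refl , refl }) ((n ≟ n') ×-dec (k ≟ k'))

open import Data.List.Membership.DecPropositional _≟Sym_ using (_∈?_)

all-update : ∀ {A : Set} {P : A → Set} {n} {xs : Vec A n} {y} →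
  VAll.All P xs → ∀ i → P y → VAll.All P (xs [ i ]≔ y)
all-update (_ VAll.∷ ps) zero    q = q VAll.∷ ps
all-update (p VAll.∷ ps) (suc i) q = p VAll.∷ all-update ps i q

node-injective : ∀ {Q f g} {v : Vec (Tm Q) (ar f)} {w : Vec (Tm Q) (ar g)} →
  node f v ≡ node g w → ∃ λ (p : f ≡ g) → ≡.subst (λ k → Vec (Tm Q) (ar k)) p v ≡ w
node-injective refl = refl , refl

rename : (Sym → ℕ) → Sym → Sym
rename h f = mkSym (h f) (ar f)

mutual
  ren : ∀ {Q} → (Sym → ℕ) → Tm Q → Tm Q
  ren h (var x)     = var x
  ren h (st q)      = st q
  ren h (node f ts) = node (rename h f) (rens h ts)

  rens : ∀ {Q n} → (Sym → ℕ) → Vec (Tm Q) n → Vec (Tm Q) n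
  rens h []       = []
  rens h (t ∷ ts) = ren h t ∷ rens h ts

module _ {Q : Set} (h : Sym → ℕ) where

  rens-lookup : ∀ {n} (ts : Vec (Tm Q) n) i → lookup (rens h ts) i ≡ ren h (lookup ts i)
  rens-lookup (t ∷ ts) zero    = refl
  rens-lookup (t ∷ ts) (suc i) = rens-lookup ts i

  rens-update : ∀ {n} (ts : Vec (Tm Q) n) i u → rens h (ts [ i ]≔ u) ≡ rens h ts [ i ]≔ ren h u
  rens-update (t ∷ ts) zero    u = refl
  rens-update (t ∷ ts) (suc i) u = cong (ren h t ∷_) (rens-update ts i u)

  rens-states : ∀ {n} (as : Vec Q n) → rens h (Vec.map st as) ≡ Vec.map st as
  rens-states []       = refl
  rens-states (a ∷ as) = cong (st a ∷_) (rens-states as)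

  ren-state⁻ : ∀ (t : Tm Q) {a} → ren h t ≡ st a → t ≡ st a
  ren-state⁻ (st q) refl = refl

  rens-states⁻ : ∀ {n} (ts : Vec (Tm Q) n) as → rens h ts ≡ Vec.map st as → ts ≡ Vec.map st as
  rens-states⁻ []       []       _ = refl
  rens-states⁻ (t ∷ ts) (a ∷ as) e =
    cong₂ _∷_ (ren-state⁻ t (∷-injectiveˡ e)) (rens-states⁻ ts as (∷-injectiveʳ e))

mutual
  ren-embed : ∀ {Q} h (t : Term) → ren h (embed {Q} t) ≡ embed (ren h t)
  ren-embed h (var x)     = refl
  ren-embed h (st ())
  ren-embed h (node f ts) = cong (node _) (rens-embeds h ts)

  rens-embeds : ∀ {Q n} h (ts : Vec Term n) → rens h (embeds {Q} ts) ≡ embeds (rens h ts)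
  rens-embeds h []       = refl
  rens-embeds h (t ∷ ts) = cong₂ _∷_ (ren-embed h t) (rens-embeds h ts)

module _ {Σ : RankedAlphabet} (h : Sym → ℕ) (fixes : ∀ {f} → f ∈ Σ → h f ≡ name f)
         (σ : ℕ → Term) where
  mutual
    ren-subst : ∀ {l} → Over Σ l → ren h (subst σ l) ≡ subst (ren h ∘ σ) l
    ren-subst (var x) = refl
    ren-subst {node f ts} (node f∈ os) =
      cong₂ (λ n v → node (mkSym n (ar f)) v) (fixes f∈) (rens-substs os)

    rens-substs : ∀ {n} {ts : Vec Term n} → VAll.All (Over Σ) ts →
      rens h (substs σ ts) ≡ substs (ren h ∘ σ) ts
    rens-substs VAll.[]         = refl
    rens-substs (o VAll.∷ os) = cong₂ _∷_ (ren-subst o) (rens-substs os)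

module _ {Γ : RankedAlphabet} (h h' : Sym → ℕ)
         (cancel : ∀ {f} → f ∈ Γ → h' (rename h f) ≡ name f) where
  mutual
    ren-cancel : ∀ {s} → Ground Γ s → ren h' (ren h s) ≡ s
    ren-cancel {node f ts} (node f∈ gs) =
      cong₂ (λ n v → node (mkSym n (ar f)) v) (cancel f∈) (rens-cancel gs)

    rens-cancel : ∀ {n} {ts : Vec Term n} → VAll.All (Ground Γ) ts → rens h' (rens h ts) ≡ ts
    rens-cancel VAll.[]         = refl
    rens-cancel (g VAll.∷ gs) = cong₂ _∷_ (ren-cancel g) (rens-cancel gs)

  ren-injective : ∀ {s t} → Ground Γ s → Ground Γ t → ren h s ≡ ren h t → s ≡ t
  ren-injective gs gt e = trans (sym (ren-cancel gs)) (trans (cong (ren h') e) (ren-cancel gt))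

module _ {Γ Γ' : RankedAlphabet} (h : Sym → ℕ)
         (into : ∀ {f} → f ∈ Γ → rename h f ∈ Γ') where
  mutual
    ground-ren : ∀ {t} → Ground Γ t → Ground Γ' (ren h t)
    ground-ren (node f∈ gs) = node (into f∈) (grounds-ren gs)

    grounds-ren : ∀ {n} {ts : Vec Term n} → VAll.All (Ground Γ) ts → VAll.All (Ground Γ') (rens h ts)
    grounds-ren VAll.[]         = VAll.[]
    grounds-ren (g VAll.∷ gs) = ground-ren g VAll.∷ grounds-ren gs

mutual
  subst-cong : ∀ {σ₁ σ₂ : ℕ → Term} t → (∀ x → Occurs x t → σ₁ x ≡ σ₂ x) →
    subst σ₁ t ≡ subst σ₂ t
  subst-cong (var x)     ag = ag x here
  subst-cong (st ())
  subst-cong (node f ts) ag = cong (node f) (substs-cong ts (λ x o → ag x (arg o)))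

  substs-cong : ∀ {σ₁ σ₂ : ℕ → Term} {n} (ts : Vec Term n) →
    (∀ x → VAny.Any (Occurs x) ts → σ₁ x ≡ σ₂ x) → substs σ₁ ts ≡ substs σ₂ ts
  substs-cong []       ag = refl
  substs-cong (t ∷ ts) ag =
    cong₂ _∷_ (subst-cong t (λ x o → ag x (VAny.here o))) (substs-cong ts (λ x o → ag x (VAny.there o)))

mutual
  subst-agree : ∀ {σ₁ σ₂ : ℕ → Term} {x} t → subst σ₁ t ≡ subst σ₂ t → Occurs x t → σ₁ x ≡ σ₂ x
  subst-agree (var x)     e here    = e
  subst-agree (st ())
  subst-agree (node f ts) e (arg o) with node-injective e
  ... | refl , e′ = substs-agree ts e′ o

  substs-agree : ∀ {σ₁ σ₂ : ℕ → Term} {x n} (ts : Vec Term n) →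
    substs σ₁ ts ≡ substs σ₂ ts → VAny.Any (Occurs x) ts → σ₁ x ≡ σ₂ x
  substs-agree (t ∷ ts) e (VAny.here o)  = subst-agree t (∷-injectiveˡ e) o
  substs-agree (t ∷ ts) e (VAny.there o) = substs-agree ts (∷-injectiveʳ e) o

module _ {Γ : RankedAlphabet} where

  mutual
    ground-var : ∀ {σ x} l → Ground Γ (subst σ l) → Occurs x l → Ground Γ (σ x)
    ground-var (var x)     g           here    = g
    ground-var (st ())
    ground-var (node f ts) (node _ gs) (arg o) = grounds-var ts gs o

    grounds-var : ∀ {σ x n} (ts : Vec Term n) → VAll.All (Ground Γ) (substs σ ts) →
      VAny.Any (Occurs x) ts → Ground Γ (σ x)
    grounds-var (t ∷ ts) (g VAll.∷ gs) (VAny.here o)  = ground-var t g o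
    grounds-var (t ∷ ts) (g VAll.∷ gs) (VAny.there o) = grounds-var ts gs o

  mutual
    ground-subst : ∀ {σ} r → (∀ f → SymOcc f r → f ∈ Γ) →
      (∀ x → Occurs x r → Ground Γ (σ x)) → Ground Γ (subst σ r)
    ground-subst (var x)     sy vg = vg x here
    ground-subst (st ())
    ground-subst (node f ts) sy vg =
      node (sy f here) (grounds-subst ts (λ g o → sy g (arg o)) (λ x o → vg x (arg o)))

    grounds-subst : ∀ {σ n} (ts : Vec Term n) → (∀ f → VAny.Any (SymOcc f) ts → f ∈ Γ) →
      (∀ x → VAny.Any (Occurs x) ts → Ground Γ (σ x)) → VAll.All (Ground Γ) (substs σ ts)
    grounds-subst []       sy vg = VAll.[]
    grounds-subst (t ∷ ts) sy vg =
      ground-subst t (λ f o → sy f (VAny.here o)) (λ x o → vg x (VAny.here o))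
      VAll.∷ grounds-subst ts (λ f o → sy f (VAny.there o)) (λ x o → vg x (VAny.there o))

mutual
  over-sym : ∀ {Σ f l} → Over Σ l → SymOcc f l → f ∈ Σ
  over-sym (node f∈ os) here    = f∈
  over-sym (node f∈ os) (arg o) = overs-sym os o

  overs-sym : ∀ {Σ f n} {ts : Vec Term n} → VAll.All (Over Σ) ts → VAny.Any (SymOcc f) ts → f ∈ Σ
  overs-sym (o VAll.∷ os) (VAny.here p)  = over-sym o p
  overs-sym (o VAll.∷ os) (VAny.there p) = overs-sym os p

-- For disjoint Σ, Δ and any Γ there is a renaming
-- fixing Σ, invertible on Γ, and moving Γ outside Δ: the symbols of Δ are
-- shifted above every name occurring in Σ, Δ and Γ.

record Separation (Σ Δ Γ : RankedAlphabet) : Set where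
  field
    shift unshift : Sym → ℕ
    shift-fixes   : ∀ {f} → f ∈ Σ → shift f ≡ name f
    unshift-fixes : ∀ {f} → f ∈ Σ → unshift f ≡ name f
    unshift-shift : ∀ {f} → f ∈ Γ → unshift (rename shift f) ≡ name f
    shift-avoids  : ∀ {f} → f ∈ Γ → rename shift f ∉ Δ

separation : ∀ {Σ Δ} Γ → Disjoint Σ Δ → Separation Σ Δ Γ
separation {Σ} {Δ} Γ disj = record
  { shift = shift ; unshift = unshift
  ; shift-fixes = shift-fixes ; unshift-fixes = λ f∈ → unshift-small (belowΣ f∈)
  ; unshift-shift = unshift-shift ; shift-avoids = shift-avoids }
  where
    names : List ℕ
    names = List.map name (Σ ++ Δ ++ Γ)

    N : ℕ
    N = suc (max 0 names)

    below : ∀ {f} → f ∈ Σ ++ Δ ++ Γ → name f < N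
    below f∈ = s≤s (All.lookup (xs≤max 0 names) (∈-map⁺ name f∈))

    belowΣ : ∀ {f} → f ∈ Σ → name f < N
    belowΣ f∈ = below (∈-++⁺ˡ f∈)
    belowΔ : ∀ {f} → f ∈ Δ → name f < N
    belowΔ f∈ = below (∈-++⁺ʳ Σ (∈-++⁺ˡ f∈))
    belowΓ : ∀ {f} → f ∈ Γ → name f < N
    belowΓ f∈ = below (∈-++⁺ʳ Σ (∈-++⁺ʳ Δ f∈))

    shift : Sym → ℕ
    shift f with f ∈? Δ
    ... | yes _ = N + name f
    ... | no _  = name f

    unshift : Sym → ℕ
    unshift g with N ≤? name g
    ... | yes _ = name g ∸ N
    ... | no _  = name g

    unshift-small : ∀ {g} → name g < N → unshift g ≡ name g
    unshift-small {g} g<N with N ≤? name g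
    ... | yes N≤g = ⊥-elim (<⇒≱ g<N N≤g)
    ... | no _    = refl

    shift-fixes : ∀ {f} → f ∈ Σ → shift f ≡ name f
    shift-fixes {f} f∈ with f ∈? Δ
    ... | yes f∈Δ = ⊥-elim (disj f f∈ f∈Δ)
    ... | no _    = refl

    unshift-shift : ∀ {f} → f ∈ Γ → unshift (rename shift f) ≡ name f
    unshift-shift {f} f∈ with f ∈? Δ
    ... | no _  = unshift-small (belowΓ f∈)
    ... | yes _ with N ≤? N + name f
    ...   | yes _   = m+n∸m≡n N (name f)
    ...   | no N≰ = ⊥-elim (N≰ (m≤m+n N (name f)))

    shift-avoids : ∀ {f} → f ∈ Γ → rename shift f ∉ Δ
    shift-avoids {f} f∈ with f ∈? Δ
    ... | yes _ = λ f'∈ → <⇒≱ (belowΔ f'∈) (m≤m+n N (name f))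
    ... | no f∉ = f∉

Accepts : ∀ {Γ} → BTA Γ → Term → Set
Accepts C t = ∃ λ q → BTA.final C q ≡ true × Star (BStep C) (embed t) (st q)

data Config {Q : Set} (Γ : RankedAlphabet) : Tm Q → Set where
  st   : ∀ a → Config Γ (st a)
  node : ∀ {f ts} → f ∈ Γ → VAll.All (Config Γ) ts → Config Γ (node f ts)

mutual
  config-embed : ∀ {Q Γ t} → Ground Γ t → Config {Q} Γ (embed t)
  config-embed (node f∈ gs) = node f∈ (configs-embed gs)

  configs-embed : ∀ {Q Γ n} {ts : Vec Term n} → VAll.All (Ground Γ) ts → VAll.All (Config {Q} Γ) (embeds ts)
  configs-embed VAll.[]         = VAll.[]
  configs-embed (g VAll.∷ gs) = config-embed g VAll.∷ configs-embed gs

module Pullback {Γ Γ' : RankedAlphabet} (h : Sym → ℕ) (C' : BTA Γ') where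

  n : ℕ
  n = BTA.nStates C'

  pullRule : (G : List Sym) → G ⊆ Γ → BRule Γ' n → List (BRule Γ n)
  pullRule []      inc r = []
  pullRule (f ∷ G) inc (brule g g∈ as a) with rename h f ≟Sym g
  ... | yes e = brule f (inc (here refl)) (≡.subst (λ k → Vec (Fin n) (ar k)) (sym e) as) a
                ∷ pullRule G (λ p → inc (there p)) (brule g g∈ as a)
  ... | no _     = pullRule G (λ p → inc (there p)) (brule g g∈ as a)

  pullRule-sound : ∀ G (inc : G ⊆ Γ) r {f f∈ as a} → brule f f∈ as a ∈ pullRule G inc r →
    ∃ λ g∈ → brule (rename h f) g∈ as a ≡ r
  pullRule-sound (f' ∷ G) inc (brule g g∈ as' a') m with rename h f' ≟Sym g
  pullRule-sound (f' ∷ G) inc (brule g g∈ as' a') (here refl) | yes refl = g∈ , refl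
  pullRule-sound (f' ∷ G) inc (brule g g∈ as' a') (there m)   | yes refl = pullRule-sound G _ _ m
  pullRule-sound (f' ∷ G) inc (brule g g∈ as' a') m           | no _     = pullRule-sound G _ _ m

  pullRule-complete : ∀ G (inc : G ⊆ Γ) {f g∈ as a} → f ∈ G →
    ∃ λ f∈ → brule f f∈ as a ∈ pullRule G inc (brule (rename h f) g∈ as a)
  pullRule-complete (f' ∷ G) inc {f} f∈G with rename h f' ≟Sym rename h f
  pullRule-complete (f' ∷ G) inc (here refl) | yes refl = inc (here refl) , here refl
  pullRule-complete (f' ∷ G) inc (here refl) | no ≢     = ⊥-elim (≢ refl)
  pullRule-complete (f' ∷ G) inc (there p)   | yes _    = map₂ there (pullRule-complete G _ p)
  pullRule-complete (f' ∷ G) inc (there p)   | no _     = pullRule-complete G _ p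

  pullRules : List (BRule Γ n)
  pullRules = concat (List.map (pullRule Γ (λ f∈ → f∈)) (BTA.rules C'))

  pullRules-sound : ∀ {f f∈ as a} → brule f f∈ as a ∈ pullRules →
    ∃ λ g∈ → brule (rename h f) g∈ as a ∈ BTA.rules C'
  pullRules-sound m with ∈-concat⁻′ (List.map (pullRule Γ _) (BTA.rules C')) m
  ... | _ , m₁ , m₂ with ∈-map⁻ (pullRule Γ _) m₂
  ... | r , r∈ , refl with pullRule-sound Γ _ r m₁
  ... | g∈ , refl = g∈ , r∈

  pullRules-complete : ∀ {f g∈ as a} → f ∈ Γ → brule (rename h f) g∈ as a ∈ BTA.rules C' →
    ∃ λ f∈ → brule f f∈ as a ∈ pullRules
  pullRules-complete f∈ r∈ =
    map₂ (λ m → ∈-concat⁺′ m (∈-map⁺ (pullRule Γ _) r∈)) (pullRule-complete Γ _ f∈)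

  pullback : BTA Γ
  pullback = record
    { nStates = n ; final = BTA.final C' ; rules = pullRules ; epsRules = BTA.epsRules C' }

  move-forward : ∀ {s s'} → BStep pullback s s' → BStep C' (ren h s) (ren h s')
  move-forward (rule {as = as} m) rewrite rens-states h as = rule (proj₂ (pullRules-sound m))
  move-forward (eps m) = eps m
  move-forward (arg {ts = ts} {u} i mv) rewrite rens-update h ts i u =
    arg i (≡.subst (λ z → BStep C' z (ren h u)) (sym (rens-lookup h ts i)) (move-forward mv))

  move-backward : ∀ {x u s} → BStep C' x u → x ≡ ren h s → Config Γ s →
    ∃ λ s' → u ≡ ren h s' × BStep pullback s s' × Config Γ s'
  move-backward (rule m) () (st _)
  move-backward (rule {as = as} {a} m) eq (node {ts = ss} f∈ _) with node-injective eq
  ... | refl , e rewrite rens-states⁻ h ss as (sym e) =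
    st a , refl , rule (proj₂ (pullRules-complete f∈ m)) , st a
  move-backward (eps {a' = a'} m) refl (st _) = st a' , refl , eps m , st a'
  move-backward (eps m) () (node _ _)
  move-backward (arg i mv) () (st _)
  move-backward (arg i mv) refl (node {f} {ss} f∈ cs)
    with move-backward mv (rens-lookup h ss i) (VAll.lookup⁺ cs i)
  ... | s' , refl , mv' , c' =
    node f (ss [ i ]≔ s') , cong (node (rename h f)) (sym (rens-update h ss i s')) ,
    arg i mv' , node f∈ (all-update cs i c')

  run-backward : ∀ {x q s} → Star (BStep C') x (st q) → x ≡ ren h s → Config Γ s →
    Star (BStep pullback) s (st q)
  run-backward ε eq c rewrite ren-state⁻ h _ (sym eq) = ε
  run-backward (mv ◅ run) eq c with move-backward mv eq c
  ... | s' , eq' , mv' , c' = mv' ◅ run-backward run eq' c'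

  accepts-forward : ∀ {t} → Accepts pullback t → Accepts C' (ren h t)
  accepts-forward {t} (q , fin , run) =
    q , fin , ≡.subst (λ z → Star (BStep C') z (st q)) (ren-embed h t) (gmap (ren h) move-forward run)

  accepts-backward : ∀ {t} → Ground Γ t → Accepts C' (ren h t) → Accepts pullback t
  accepts-backward {t} g (q , fin , run) =
    q , fin , run-backward run (sym (ren-embed h t)) (config-embed g)

Reach : TRS → List Term → Term → Set
Reach R L t = ∃ λ q → q ∈ L × (q ⇒*[ R ] t)

module Simulation {Σ Δ Γ : RankedAlphabet} {A B T : TRS}
  (hA : IsTRSOver Σ A) (hB : IsTRSOver Δ B) (nvB : NoVariableLhs B)
  (split : ∀ {l r} → (l , r) ∈ T → (l , r) ∈ A ⊎ (l , r) ∈ B)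
  (injA : ∀ {l r} → (l , r) ∈ A → (l , r) ∈ T)
  (sA : SignSubset A Γ) (sep : Separation Σ Δ Γ) where

  open Separation sep

  rn : Term → Term
  rn = ren shift

  -- an A-step is mirrored by a T-step between the renamed terms, since
  -- the renaming fixes the symbols of A's rules
  step-forward : ∀ {s s'} → Step A s s' → Step T (rn s) (rn s')
  step-forward (root σ m) =
    ≡.subst₂ (Step T) (sym (ren-subst shift shift-fixes σ (proj₁ (hA m))))
                      (sym (ren-subst shift shift-fixes σ (proj₁ (proj₂ (hA m)))))
      (root (rn ∘ σ) (injA m))
  step-forward (arg {ts = ts} {u} i stp) rewrite rens-update shift ts i u =
    arg i (≡.subst (λ z → Step T z (rn u)) (sym (rens-lookup shift ts i)) (step-forward stp))

  -- a B-rule never applies at the root of a renamed ground Γ-term: its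
  -- lhs is headed by a symbol of Δ, which the renaming avoids
  no-B-redex : ∀ {l r σ s} → (l , r) ∈ B → subst σ l ≡ rn s → Ground Γ s → ⊥
  no-B-redex {var x} m _ _ = nvB m (x , refl)
  no-B-redex {st ()}
  no-B-redex {node f ls} m eq (node g∈ _) with proj₁ (hB m)
  ... | node f∈ _ with node-injective eq
  ... | refl , _ = shift-avoids g∈ f∈

  -- an A-redex in a renamed ground Γ-term is the renaming of an A-redex:
  -- undoing the renaming on the matching substitution gives the redex
  A-redex-backward : ∀ {l r σ s} → (l , r) ∈ A → subst σ l ≡ rn s → Ground Γ s →
    ∃ λ s' → subst σ r ≡ rn s' × Step A s s' × Ground Γ s'
  A-redex-backward {l} {r} {σ} {s} m eq gs =
    subst σ' r , ueq , ≡.subst (λ z → Step A z (subst σ' r)) (sym s≡) (root σ' m) , gs'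
    where
      overL : Over Σ l
      overL = proj₁ (hA m)
      σ' : ℕ → Term
      σ' = ren unshift ∘ σ
      s≡ : s ≡ subst σ' l
      s≡ = trans (sym (ren-cancel shift unshift unshift-shift gs))
                 (trans (cong (ren unshift) (sym eq)) (ren-subst unshift unshift-fixes σ overL))
      agree : ∀ x → Occurs x l → σ x ≡ rn (σ' x)
      agree x = subst-agree l (trans eq (trans (cong rn s≡) (ren-subst shift shift-fixes σ' overL)))
      ueq : subst σ r ≡ rn (subst σ' r)
      ueq = trans (subst-cong r (λ x o → agree x (proj₂ (proj₂ (hA m)) x o)))
                  (sym (ren-subst shift shift-fixes σ' (proj₁ (proj₂ (hA m)))))
      gs' : Ground Γ (subst σ' r)
      gs' = ground-subst r (λ f o → proj₂ (sA m f) o)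
              (λ x o → ground-var l (≡.subst (Ground Γ) s≡ gs) (proj₂ (proj₂ (hA m)) x o))

  step-backward : ∀ {x u s} → Step T x u → x ≡ rn s → Ground Γ s →
    ∃ λ s' → u ≡ rn s' × Step A s s' × Ground Γ s'
  step-backward (root σ m) eq gs with split m
  ... | inj₁ mA = A-redex-backward mA eq gs
  ... | inj₂ mB = ⊥-elim (no-B-redex mB eq gs)
  step-backward (arg i stp) refl (node {f} {ss} f∈ gs)
    with step-backward stp (rens-lookup shift ss i) (VAll.lookup⁺ gs i)
  ... | s' , refl , stp' , g' =
    node f (ss [ i ]≔ s') , cong (node (rename shift f)) (sym (rens-update shift ss i s')) ,
    arg i stp' , node f∈ (all-update gs i g')

  steps-backward : ∀ {x z s} → x ⇒*[ T ] z → x ≡ rn s → Ground Γ s →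
    ∃ λ s' → z ≡ rn s' × s ⇒*[ A ] s' × Ground Γ s'
  steps-backward ε eq gs = _ , eq , ε , gs
  steps-backward (stp ◅ run) eq gs with step-backward stp eq gs
  ... | s' , eq' , stp' , gs' with steps-backward run eq' gs'
  ... | s'' , eq'' , run' , gs'' = s'' , eq'' , stp' ◅ run' , gs''

  reach-forward : ∀ {L t} → Reach A L t → Reach T (List.map rn L) (rn t)
  reach-forward (q , q∈ , run) = rn q , ∈-map⁺ rn q∈ , gmap rn step-forward run

  reach-backward : ∀ {L t} → All (Ground Γ) L → Ground Γ t →
    Reach T (List.map rn L) (rn t) → Reach A L t
  reach-backward gL gt (_ , q'∈ , run) with ∈-map⁻ rn q'∈
  ... | q , q∈ , refl with steps-backward run refl (All.lookup gL q∈)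
  ... | s' , e , run' , gs' =
    q , q∈ , ≡.subst (q ⇒*[ A ]_) (sym (ren-injective shift unshift unshift-shift gt gs' e)) run'

eprf-component : ∀ {Σ Δ} {A B T : TRS} →
  IsTRSOver Σ A → IsTRSOver Δ B → Disjoint Σ Δ → NoVariableLhs B →
  (∀ {l r} → (l , r) ∈ T → (l , r) ∈ A ⊎ (l , r) ∈ B) →
  (∀ {l r} → (l , r) ∈ A → (l , r) ∈ T) →
  EPRF T → EPRF A
eprf-component {Σ} {Δ} {A} {B} {T} hA hB disj nvB split injA eprfT Γ sA L gL =
  pullback , correct
  where
    sep : Separation Σ Δ Γ
    sep = separation Γ disj
    open Separation sep
    open Simulation hA hB nvB split injA sA sep

    -- the renamed alphabet Γ' = φ(Γ) ∪ Δ contains sign(T)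
    Γ' : RankedAlphabet
    Γ' = List.map (rename shift) Γ ++ Δ

    into : ∀ {f} → f ∈ Γ → rename shift f ∈ Γ'
    into f∈ = ∈-++⁺ˡ (∈-map⁺ (rename shift) f∈)

    fixed-into : ∀ {f} → f ∈ Σ → f ∈ Γ → f ∈ Γ'
    fixed-into {f} f∈Σ f∈Γ = ≡.subst (_∈ Γ') (cong (λ k → mkSym k (ar f)) (shift-fixes f∈Σ)) (into f∈Γ)

    signT : SignSubset T Γ'
    signT m f with split m
    ... | inj₁ mA = (λ o → fixed-into (over-sym (proj₁ (hA mA)) o) (proj₁ (sA mA f) o))
                  , (λ o → fixed-into (over-sym (proj₁ (proj₂ (hA mA))) o) (proj₂ (sA mA f) o))
    ... | inj₂ mB = (λ o → ∈-++⁺ʳ _ (over-sym (proj₁ (hB mB)) o))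
                  , (λ o → ∈-++⁺ʳ _ (over-sym (proj₁ (proj₂ (hB mB))) o))

    C'-spec : ∃ λ (C' : BTA Γ') → ∀ t → Lang C' t ⇔ Desc T Γ' (List.map rn L) t
    C'-spec = eprfT Γ' signT (List.map rn L) (All.map⁺ (All.map (ground-ren shift into) gL))
    C' : BTA Γ'
    C' = proj₁ C'-spec
    open Pullback shift C'

    -- t ∈ L(pullback)  ⇔  rn t ∈ L(C') = T*(rn L)  ⇔  t ∈ A*(L)
    correct : ∀ t → Lang pullback t ⇔ Desc A Γ L t
    correct t = mk⇔
      (λ (gt , acc) → gt , reach-backward gL gt (proj₂ (to (ground-ren shift into gt , accepts-forward acc))))
      (λ (gt , reach) → gt , accepts-backward gt (proj₂ (from (ground-ren shift into gt , reach-forward reach))))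
      where open Equivalence (proj₂ C'-spec (rn t))

mainTheorem19 : (Σ Δ : RankedAlphabet) (R S : TRS) →
    IsTRSOver Σ R → IsTRSOver Δ S → Disjoint Σ Δ →
    NoVariableLhs (R ⊕ S) →
    EPRF (R ⊕ S) → EPRF R × EPRF S
mainTheorem19 Σ Δ R S hR hS disj nv eprf =
  eprf-component hR hS disj (nv ∘ ∈-++⁺ʳ R) (∈-++⁻ R) ∈-++⁺ˡ eprf ,
  eprf-component hS hR (λ f p q → disj f q p) (nv ∘ ∈-++⁺ˡ) (swap ∘ ∈-++⁻ R) (∈-++⁺ʳ R) eprf
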